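{- Let $G=(V,E)$ be a connected graph, $k$ an integer, and $T$ a spanning tree of $G$ with congestion at most $k$. Let $\rho_1,\rho_2$ be positive reals with $\rho_1\rho_2 \ge 1/2$ and $\rho_2 \ge 1/2$. Let $S \subseteq V$ be a set of at least four vertices such that $|S| \ge \rho_1 k + 1$ and $\delta(G[S]) \ge \rho_2 |S| + 1$. If $T'$ is the (inclusion-)minimal subtree of $T$ containing all vertices of $S$, then $T'$ is a spider having a branching vertex, such that (i) every vertex of degree $2$ in $T'$ (if any) belongs to $V \setminus S$, and (ii) the degree in $T'$ of the branching vertex of $T'$ is at least $|S|-1$.
   Context: For a spanning tree $T$ of $G$ and $e \in E(T)$, the congestion of $e$ is the number of edges of $G$ between the vertex sets of the two components of $T-e$; the congestion of $T$ is the maximum congestion over edges of $T$. $\delta(H)$ denotes the minimum degree of a graph $H$, and $G[S]$ the subgraph induced by $S$. In a tree, a vertex of degree at least $3$ is a branching vertex; a tree is a spider if it has at most one branching vertex.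
   Formalization: The parameters ρ₁ and ρ₂ range over the positive rationals instead of the positive reals. -}

module Defs where

open import Data.Nat using (ℕ; zero; suc; _+_)
open import Data.Bool using (Bool; true; false; _∧_; _∨_; not; if_then_else_)
open import Data.Fin using (Fin)
open import Data.Fin.Properties using (_≟_)
open import Data.List using (List; map; allFin)
open import Data.Nat.ListAction using (sum)
open import Data.Product using (_×_)
open import Data.Integer as ℤ using (ℤ; +_)
open import Data.Rational using (ℚ; _/_)
open import Relation.Nullary using (¬_)
open import Relation.Nullary.Decidable using (⌊_⌋)
open import Relation.Binary.PropositionalEquality using (_≡_)

record Graph (n : ℕ) : Set where
  field
    adj     : Fin n → Fin n → Bool
    adj-sym : ∀ x y → adj x y ≡ adj y x
    irrefl  : ∀ x → adj x x ≡ false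
open Graph public

VSet : ℕ → Set
VSet n = Fin n → Bool

data Reach {n : ℕ} (A : Fin n → Fin n → Bool) : Fin n → Fin n → Set where
  here : ∀ {u} → Reach A u u
  step : ∀ {u v w} → A u v ≡ true → Reach A v w → Reach A u w

Connected : ∀ {n} → Graph n → Set
Connected G = ∀ u v → Reach (adj G) u v

removeEdge : ∀ {n} → (Fin n → Fin n → Bool) → Fin n → Fin n → Fin n → Fin n → Bool
removeEdge A u v x y =
  A x y ∧ not ((⌊ x ≟ u ⌋ ∧ ⌊ y ≟ v ⌋) ∨ (⌊ x ≟ v ⌋ ∧ ⌊ y ≟ u ⌋))

IsTree : ∀ {n} → Graph n → Set
IsTree T = Connected T ×
  (∀ u v → adj T u v ≡ true → ¬ Reach (removeEdge (adj T) u v) u v)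

IsSpanningTree : ∀ {n} → Graph n → Graph n → Set
IsSpanningTree G T =
  (∀ x y → adj T x y ≡ true → adj G x y ≡ true) × IsTree T

b2n : Bool → ℕ
b2n true  = 1
b2n false = 0

count : ∀ {n} → (Fin n → Bool) → ℕ
count {n} P = sum (map (λ x → b2n (P x)) (allFin n))

card : ∀ {n} → VSet n → ℕ
card S = count S

-- number of edges of G with one end in X and the other outside X
-- (each such edge is counted once, by its end in X)
crossing : ∀ {n} → Graph n → VSet n → ℕ
crossing {n} G X =
  sum (map (λ a → count (λ b → X a ∧ not (X b) ∧ adj G a b)) (allFin n))

IsComponentOfRemoval : ∀ {n} → Graph n → Fin n → Fin n → VSet n → Set
IsComponentOfRemoval T u v X =
  ∀ w → (X w ≡ true → Reach (removeEdge (adj T) u v) u w)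
      × (Reach (removeEdge (adj T) u v) u w → X w ≡ true)

-- congestion of T (w.r.t. G) is at most k: for every tree edge uv, the
-- number of G-edges between the two components of T - uv is at most k
CongestionAtMost : ∀ {n} → Graph n → Graph n → ℤ → Set
CongestionAtMost G T k =
  ∀ u v → adj T u v ≡ true → ∀ X → IsComponentOfRemoval T u v X →
  + crossing G X ℤ.≤ k

_⊆_ : ∀ {n} → VSet n → VSet n → Set
X ⊆ Y = ∀ x → X x ≡ true → Y x ≡ true

inducedAdj : ∀ {n} → (Fin n → Fin n → Bool) → VSet n → Fin n → Fin n → Bool
inducedAdj A W x y = W x ∧ W y ∧ A x y

degIn : ∀ {n} → Graph n → VSet n → Fin n → ℕ
degIn H W w = count (λ x → W x ∧ adj H w x)

-- W spans a subtree of the tree T (T[W] is connected; being a subgraph of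
-- a tree it is then a tree)
IsSubtreeSet : ∀ {n} → Graph n → VSet n → Set
IsSubtreeSet T W = ∀ x y → W x ≡ true → W y ≡ true → Reach (inducedAdj (adj T) W) x y

IsMinimalSubtreeContaining : ∀ {n} → Graph n → VSet n → VSet n → Set
IsMinimalSubtreeContaining T S W =
  S ⊆ W × IsSubtreeSet T W ×
  (∀ W' → W' ⊆ W → S ⊆ W' → IsSubtreeSet T W' → W ⊆ W')

ℕ→ℚ : ℕ → ℚ
ℕ→ℚ m = + m / 1

ℤ→ℚ : ℤ → ℚ
ℤ→ℚ k = k / 1

{-# OPTIONS --safe #-}
module Submission where

-- Call the vertices of S terminals. Removing an edge uv of T' splits the terminals into those on
-- u's side and those on v's side, both nonempty by minimality of T'. Not both sides can hold two
-- or more: if the smaller side held a ≥ 2 terminals, their degrees in G[S] would sum to at least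
-- a(ρ₂|S| + 1) but at most a(a − 1) plus the congestion k ≤ (|S| − 1)/ρ₁, which ρ₁ρ₂ ≥ 1/2 and
-- ρ₂ ≥ 1/2 rule out. Call w a hub if every branch of T' at w carries exactly one terminal; then
-- the terminals other than w lie in distinct branches, so deg w ≥ |S| − 1. A non-hub w has a
-- branch x beyond which lie ≥ 2 terminals, so w's side of wx holds a single terminal, which every
-- other branch at w must contain: hence deg w ≤ 2, and w ∉ S if deg w = 2. A hub exists and is
-- unique because non-backtracking walks in a finite tree terminate.

open import Defs
open import Data.Nat using (ℕ)

module Arithmetic where

  open import Data.Nat
  open import Data.Nat.Properties
  open import Data.Nat.Tactic.RingSolver using (solve; solve-∀)
  open import Data.List using ([]; _∷_)
  open import Data.Empty using (⊥; ⊥-elim)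
  open import Function using (_$_)
  open import Relation.Binary.PropositionalEquality using (_≡_)
  open ≤-Reasoning

  -- With ρ₁ = p₁/q₁ and ρ₂ = p₂/q₂ this reads  c ≤ (s − 1)/ρ₁ ≤ 2ρ₂(s − 1).
  congestion-bound : ∀ p₁ q₁ p₂ q₂ c s .{{_ : NonZero p₁}} .{{_ : NonZero q₁}} →
    q₁ * q₂ ≤ 2 * (p₁ * p₂) → p₁ * c + q₁ ≤ q₁ * s → q₂ * c + 2 * p₂ ≤ 2 * p₂ * s
  congestion-bound p₁ q₁ p₂ q₂ c zero _ ρ₁c+1≤s =
    ⊥-elim (<⇒≱ (>-nonZero⁻¹ q₁) (≤-trans (m≤n+m q₁ (p₁ * c)) (≤-trans ρ₁c+1≤s (≤-reflexive (*-zeroʳ q₁)))))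
  congestion-bound p₁ q₁ p₂ q₂ c (suc t) ρ₁ρ₂≥½ ρ₁c+1≤s = begin
    q₂ * c + 2 * p₂       ≤⟨ +-monoˡ-≤ (2 * p₂) (*-cancelˡ-≤ p₁ p₁q₂c≤) ⟩
    2 * p₂ * t + 2 * p₂   ≡⟨ solve (p₂ ∷ t ∷ []) ⟩
    2 * p₂ * suc t        ∎
    where
    p₁q₂c≤ : p₁ * (q₂ * c) ≤ p₁ * (2 * p₂ * t)
    p₁q₂c≤ = +-cancelˡ-≤ (q₁ * q₂) _ _ $ begin
      q₁ * q₂ + p₁ * (q₂ * c)       ≡⟨ solve (q₁ ∷ q₂ ∷ p₁ ∷ c ∷ []) ⟩
      q₂ * (p₁ * c + q₁)            ≤⟨ *-monoʳ-≤ q₂ ρ₁c+1≤s ⟩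
      q₂ * (q₁ * suc t)             ≡⟨ solve (q₁ ∷ q₂ ∷ t ∷ []) ⟩
      q₁ * q₂ + q₁ * q₂ * t         ≤⟨ +-monoʳ-≤ (q₁ * q₂) (*-monoˡ-≤ t ρ₁ρ₂≥½) ⟩
      q₁ * q₂ + 2 * (p₁ * p₂) * t   ≡⟨ solve (q₁ ∷ q₂ ∷ p₁ ∷ p₂ ∷ t ∷ []) ⟩
      q₁ * q₂ + p₁ * (2 * p₂ * t)   ∎

  -- For 2 ≤ a ≤ ρs (ρ = p/q): a(ρs + 2 − a) ≥ 2ρs > 2ρ(s − 1).
  quadratic-gap : ∀ p q s a .{{_ : NonZero p}} → 2 ≤ a → q * a ≤ p * s →
    2 * p * s + q * (a * (a ∸ 1)) < a * (p * s + q) + 2 * p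
  quadratic-gap p q s a@(suc (suc α)) (s≤s (s≤s z≤n)) qa≤ps = begin-strict
    2 * p * s + q * (a * suc α)               ≡⟨ solve (p ∷ q ∷ s ∷ α ∷ []) ⟩
    2 * p * s + q * a + α * (q * a)           ≤⟨ +-monoʳ-≤ (2 * p * s + q * a) (*-monoʳ-≤ α qa≤ps) ⟩
    2 * p * s + q * a + α * (p * s)           <⟨ m<m+n _ (≤-trans (>-nonZero⁻¹ p) (m≤n*m p 2)) ⟩
    2 * p * s + q * a + α * (p * s) + 2 * p   ≡⟨ solve (p ∷ q ∷ s ∷ α ∷ []) ⟩
    a * (p * s + q) + 2 * p                   ∎

  -- a ≥ 2 terminals on the smaller side of a cut of congestion c: their degrees in G[S] sum to
  -- at least a(ρ₂s + 1) and at most c + a(a − 1).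
  balanced-cut-absurd : ∀ p₁ q₁ p₂ q₂ c s a .{{_ : NonZero p₁}} .{{_ : NonZero q₁}} .{{_ : NonZero p₂}} →
    q₁ * q₂ ≤ 2 * (p₁ * p₂) → q₂ ≤ 2 * p₂ → p₁ * c + q₁ ≤ q₁ * s →
    2 ≤ a → 2 * a ≤ s → a * (p₂ * s + q₂) ≤ q₂ * (c + a * (a ∸ 1)) → ⊥
  balanced-cut-absurd p₁ q₁ p₂ q₂ c s a ρ₁ρ₂≥½ ρ₂≥½ ρ₁c+1≤s 2≤a 2a≤s degree-sum≤ =
    <⇒≱ (quadratic-gap p₂ q₂ s a 2≤a q₂a≤p₂s) $ begin
      a * (p₂ * s + q₂) + 2 * p₂               ≤⟨ +-monoˡ-≤ (2 * p₂) degree-sum≤ ⟩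
      q₂ * (c + a * (a ∸ 1)) + 2 * p₂          ≡⟨ rearrange q₂ c (a * (a ∸ 1)) (2 * p₂) ⟩
      q₂ * c + 2 * p₂ + q₂ * (a * (a ∸ 1))
        ≤⟨ +-monoˡ-≤ (q₂ * (a * (a ∸ 1))) (congestion-bound p₁ q₁ p₂ q₂ c s ρ₁ρ₂≥½ ρ₁c+1≤s) ⟩
      2 * p₂ * s + q₂ * (a * (a ∸ 1))          ∎
    where
    rearrange : ∀ x y z w → x * (y + z) + w ≡ x * y + w + x * z
    rearrange = solve-∀
    q₂a≤p₂s : q₂ * a ≤ p₂ * s
    q₂a≤p₂s = *-cancelˡ-≤ 2 $ begin
      2 * (q₂ * a)   ≡⟨ solve (q₂ ∷ a ∷ []) ⟩
      q₂ * (2 * a)   ≤⟨ *-monoʳ-≤ q₂ 2a≤s ⟩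
      q₂ * s         ≤⟨ *-monoˡ-≤ s ρ₂≥½ ⟩
      2 * p₂ * s     ≡⟨ *-assoc 2 p₂ s ⟩
      2 * (p₂ * s)   ∎


module Counting where

  open import Defs using (VSet; b2n; count; _⊆_)
  open import Data.Nat using (ℕ; zero; suc; _+_; _≤_; _<_; _≤?_; z≤n; s≤s)
  open import Data.Nat.Properties
    using (+-*-semiring; +-mono-≤; +-monoˡ-≤; +-mono-<-≤; +-mono-≤-<; ≤-refl; ≤-trans; ≤-pred; suc-injective; module ≤-Reasoning)
  open import Algebra.Properties.Semiring.Sum +-*-semiring using (sum; ∑-distrib-+; sum-cong-≗; sum-replicate-zero)
  import Data.Nat.ListAction as List
  open import Data.Bool using (true; false; _∧_; not)
  open import Data.Bool.Properties using (∧-conicalˡ; ∧-conicalʳ; ∧-zeroʳ; ∧-identityʳ; ¬-not; not-¬)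
  open import Data.Fin as Fin using (Fin; zero; suc)
  open import Data.Fin.Properties using (_≟_)
  open import Data.List using (map; allFin; tabulate)
  open import Data.List.Properties using (map-tabulate)
  open import Data.Product using (∃-syntax; _×_; _,_)
  open import Function using (_∘_; _$_)
  open import Data.Sum using (_⊎_; inj₁; inj₂)
  open import Data.Empty using (⊥-elim)
  open import Relation.Nullary using (¬_; yes; no)
  open import Relation.Nullary.Decidable using (⌊_⌋)
  open import Relation.Binary.PropositionalEquality

  private variable
    n : ℕ
    P Q : VSet n
    x y z : Fin n

  infix 4 _∈_
  infixr 7 _∩_
  infixl 6 _∖_

  _∈_ : Fin n → VSet n → Set
  x ∈ X = X x ≡ true

  _∩_ : VSet n → VSet n → VSet n
  (X ∩ Y) x = X x ∧ Y x

  _∖_ : VSet n → VSet n → VSet n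
  (X ∖ Y) x = X x ∧ not (Y x)

  ｛_｝ : Fin n → VSet n
  ｛ z ｝ x = ⌊ x ≟ z ⌋

  ∉⇒≡false : {P : VSet n} {x : Fin n} → ¬ x ∈ P → P x ≡ false
  ∉⇒≡false = ¬-not

  module _ {n} {P Q : VSet n} {x : Fin n} where

    ∩-intro : x ∈ P → x ∈ Q → x ∈ P ∩ Q
    ∩-intro x∈P x∈Q rewrite x∈P = x∈Q

    ∩-projₗ : x ∈ P ∩ Q → x ∈ P
    ∩-projₗ = ∧-conicalˡ (P x) (Q x)

    ∩-projᵣ : x ∈ P ∩ Q → x ∈ Q
    ∩-projᵣ = ∧-conicalʳ (P x) (Q x)

    ∖-intro : x ∈ P → ¬ x ∈ Q → x ∈ P ∖ Q
    ∖-intro x∈P x∉Q rewrite x∈P | ∉⇒≡false {P = Q} x∉Q = refl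

    ∖-projₗ : x ∈ P ∖ Q → x ∈ P
    ∖-projₗ = ∧-conicalˡ (P x) (not (Q x))

    ∖-projᵣ : x ∈ P ∖ Q → ¬ x ∈ Q
    ∖-projᵣ x∈P∖Q x∈Q with () ←
      trans (sym (∧-zeroʳ (P x))) (subst (λ b → P x ∧ not b ≡ true) x∈Q x∈P∖Q)

  ∈｛｝⇒≡ : x ∈ ｛ z ｝ → x ≡ z
  ∈｛｝⇒≡ {x = x} {z} x∈z with x ≟ z
  ... | yes x≡z = x≡z


  ∈｛_｝ : (z : Fin n) → z ∈ ｛ z ｝
  ∈｛ z ｝ with z ≟ z
  ... | yes _ = refl
  ... | no z≢z = ⊥-elim (z≢z refl)

  ∖｛｝⇒≢ : x ∈ P ∖ ｛ z ｝ → ¬ x ≡ z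
  ∖｛｝⇒≢ {x = x} {P = P} {z} x∈ refl = ∖-projᵣ {P = P} {Q = ｛ z ｝} x∈ (∈｛ z ｝)


  sum-mono : {f g : Fin n → ℕ} → (∀ i → f i ≤ g i) → sum f ≤ sum g
  sum-mono {zero} _ = z≤n
  sum-mono {suc n} f≤g = +-mono-≤ (f≤g zero) (sum-mono (f≤g ∘ suc))

  sum-mono-< : {f g : Fin n → ℕ} → (∀ i → f i ≤ g i) → ∀ z → f z < g z → sum f < sum g
  sum-mono-< {suc n} f≤g zero f<g = +-mono-<-≤ f<g (sum-mono (f≤g ∘ suc))
  sum-mono-< {suc n} f≤g (suc z) f<g = +-mono-≤-< (f≤g zero) (sum-mono-< (f≤g ∘ suc) z f<g)

  listSum-allFin : (f : Fin n → ℕ) → List.sum (map f (allFin n)) ≡ sum f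
  listSum-allFin {n} f = trans (cong List.sum (map-tabulate {n = n} (λ i → i) f)) (listSum-tabulate f)
    where
    listSum-tabulate : ∀ {n} (f : Fin n → ℕ) → List.sum (tabulate f) ≡ sum f
    listSum-tabulate {zero} f = refl
    listSum-tabulate {suc n} f = cong (f zero +_) (listSum-tabulate (f ∘ suc))

  count≡sum : (P : VSet n) → count P ≡ sum (b2n ∘ P)
  count≡sum P = listSum-allFin (b2n ∘ P)

  private

    ∣_∣ : VSet n → ℕ
    ∣ P ∣ = sum (b2n ∘ P)

    b2n-mono : ∀ {a b} → (a ≡ true → b ≡ true) → b2n a ≤ b2n b
    b2n-mono {true} a⇒b rewrite a⇒b refl = ≤-refl
    b2n-mono {false} _ = z≤n

    b2n-split : ∀ a b → b2n a ≡ b2n (a ∧ b) + b2n (a ∧ not b)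
    b2n-split true true = refl
    b2n-split true false = refl
    b2n-split false _ = refl

    ∣∣≤n : (P : VSet n) → ∣ P ∣ ≤ n
    ∣∣≤n {zero} P = z≤n
    ∣∣≤n {suc n} P = +-mono-≤ (b2n≤1 (P zero)) (∣∣≤n (P ∘ suc))
      where
      b2n≤1 : ∀ a → b2n a ≤ 1
      b2n≤1 true = ≤-refl
      b2n≤1 false = z≤n

    ∣｛｝∣ : (z : Fin n) → ∣ ｛ z ｝ ∣ ≡ 1
    ∣｛｝∣ {suc n} zero = cong suc (sum-replicate-zero n)
    ∣｛｝∣ {suc n} (suc z) = trans (sum-cong-≗ (cong b2n ∘ suc≟suc z)) (∣｛｝∣ z)
      where
      suc≟suc : ∀ {n} (z x : Fin n) → ⌊ suc x ≟ suc z ⌋ ≡ ⌊ x ≟ z ⌋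
      suc≟suc z x with x ≟ z
      ... | yes _ = refl
      ... | no _ = refl

    ∣∣-witness : (P : VSet n) → 1 ≤ ∣ P ∣ → ∃[ x ] x ∈ P
    ∣∣-witness {suc n} P 1≤∣P∣ with P zero in P0
    ... | true = zero , P0
    ... | false with ∣∣-witness (P ∘ suc) 1≤∣P∣
    ...   | x , x∈P = suc x , x∈P

  count-cong : (∀ x → P x ≡ Q x) → count P ≡ count Q
  count-cong {P = P} {Q} P≗Q =
    trans (count≡sum P) (trans (sum-cong-≗ (cong b2n ∘ P≗Q)) (sym (count≡sum Q)))

  count-mono : P ⊆ Q → count P ≤ count Q
  count-mono {P = P} {Q} P⊆Q =
    subst₂ _≤_ (sym (count≡sum P)) (sym (count≡sum Q)) (sum-mono (λ x → b2n-mono (P⊆Q x)))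

  count-mono-< : P ⊆ Q → z ∈ Q → ¬ z ∈ P → count P < count Q
  count-mono-< {P = P} {Q} {z} P⊆Q z∈Q z∉P =
    subst₂ _<_ (sym (count≡sum P)) (sym (count≡sum Q))
      (sum-mono-< (λ x → b2n-mono (P⊆Q x)) z
        (subst₂ (λ a b → b2n a < b2n b) (sym (∉⇒≡false {P = P} z∉P)) (sym z∈Q) ≤-refl))

  count≤n : (P : VSet n) → count P ≤ n
  count≤n P = subst (_≤ _) (sym (count≡sum P)) (∣∣≤n P)

  count-split : (P Q : VSet n) → count P ≡ count (P ∩ Q) + count (P ∖ Q)
  count-split P Q = begin
    count P                             ≡⟨ count≡sum P ⟩
    ∣ P ∣                               ≡⟨ sum-cong-≗ (λ x → b2n-split (P x) (Q x)) ⟩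
    sum (λ x → b2n ((P ∩ Q) x) + b2n ((P ∖ Q) x)) ≡⟨ ∑-distrib-+ (b2n ∘ (P ∩ Q)) (b2n ∘ (P ∖ Q)) ⟩
    ∣ P ∩ Q ∣ + ∣ P ∖ Q ∣               ≡⟨ sym (cong₂ _+_ (count≡sum (P ∩ Q)) (count≡sum (P ∖ Q))) ⟩
    count (P ∩ Q) + count (P ∖ Q)       ∎
    where open ≡-Reasoning

  count-singleton : (z : Fin n) → count ｛ z ｝ ≡ 1
  count-singleton z = trans (count≡sum ｛ z ｝) (∣｛｝∣ z)

  count-witness : (P : VSet n) → 1 ≤ count P → ∃[ x ] x ∈ P
  count-witness P 1≤ = ∣∣-witness P (subst (1 ≤_) (count≡sum P) 1≤)

  count-remove : z ∈ P → count P ≡ suc (count (P ∖ ｛ z ｝))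
  count-remove {z = z} {P = P} z∈P = begin
    count P                                   ≡⟨ count-split P ｛ z ｝ ⟩
    count (P ∩ ｛ z ｝) + count (P ∖ ｛ z ｝)
      ≡⟨ cong (_+ count (P ∖ ｛ z ｝)) (trans (count-cong P∩z≗z) (count-singleton z)) ⟩
    suc (count (P ∖ ｛ z ｝))                   ∎
    where
    open ≡-Reasoning
    P∩z≗z : ∀ x → (P ∩ ｛ z ｝) x ≡ ｛ z ｝ x
    P∩z≗z x with x ≟ z
    ... | yes refl = trans (∧-identityʳ (P x)) z∈P
    ... | no _ = ∧-zeroʳ (P x)

  count-≤-remove : (P : VSet n) (z : Fin n) → count P ≤ suc (count (P ∖ ｛ z ｝))
  count-≤-remove P z = begin
    count P                                   ≡⟨ count-split P ｛ z ｝ ⟩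
    count (P ∩ ｛ z ｝) + count (P ∖ ｛ z ｝)
      ≤⟨ +-monoˡ-≤ (count (P ∖ ｛ z ｝)) (count-mono (λ x → ∩-projᵣ {P = P} {Q = ｛ z ｝} {x})) ⟩
    count ｛ z ｝ + count (P ∖ ｛ z ｝)         ≡⟨ cong (_+ count (P ∖ ｛ z ｝)) (count-singleton z) ⟩
    suc (count (P ∖ ｛ z ｝))                   ∎
    where open ≤-Reasoning

  count-nonempty : z ∈ P → 1 ≤ count P
  count-nonempty {P = P} z∈P = subst (1 ≤_) (sym (count-remove {P = P} z∈P)) (s≤s z≤n)

  count-pair : x ∈ P → y ∈ P → ¬ x ≡ y → 2 ≤ count P
  count-pair {P = P} x∈P y∈P x≢y = subst (2 ≤_) (sym (count-remove {P = P} x∈P)) $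
    s≤s (count-nonempty {P = P ∖ ｛ _ ｝} (∖-intro {P = P} {Q = ｛ _ ｝} y∈P (x≢y ∘ sym ∘ ∈｛｝⇒≡)))

  count-pair-witness : (P : VSet n) → 2 ≤ count P → ∃[ x ] ∃[ y ] (x ∈ P × y ∈ P × ¬ x ≡ y)
  count-pair-witness P 2≤ with count-witness P (≤-trans (s≤s z≤n) 2≤)
  ... | x , x∈P with count-witness (P ∖ ｛ x ｝) (≤-pred (subst (2 ≤_) (count-remove {P = P} x∈P) 2≤))
  ...   | y , y∈P∖x = x , y , x∈P , ∖-projₗ {P = P} {Q = ｛ x ｝} y∈P∖x , ∖｛｝⇒≢ {P = P} y∈P∖x ∘ sym

  count-injection : (f : ∀ x → x ∈ P → Fin n) → (∀ x x∈P → f x x∈P ∈ Q) →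
    (∀ x x∈P y y∈P → f x x∈P ≡ f y y∈P → x ≡ y) → count P ≤ count Q
  count-injection {P = P} = go (count P) refl
    where
    go : ∀ {P Q} m → count P ≡ m → (f : ∀ x → x ∈ P → Fin _) → (∀ x x∈P → f x x∈P ∈ Q) →
      (∀ x x∈P y y∈P → f x x∈P ≡ f y y∈P → x ≡ y) → m ≤ count Q
    go zero _ _ _ _ = z≤n
    go {P} {Q} (suc m) ∣P∣≡ f f∈Q f-inj with count-witness P (subst (1 ≤_) (sym ∣P∣≡) (s≤s z≤n))
    ... | z , z∈P = subst (suc m ≤_) (sym (count-remove {P = Q} (f∈Q z z∈P))) (s≤s (go m ∣P∖z∣≡ f′ f′∈ f′-inj))
      where
      ∣P∖z∣≡ : count (P ∖ ｛ z ｝) ≡ m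
      ∣P∖z∣≡ = suc-injective (trans (sym (count-remove {P = P} z∈P)) ∣P∣≡)
      f′ : ∀ x → x ∈ P ∖ ｛ z ｝ → Fin _
      f′ x x∈ = f x (∖-projₗ {P = P} {Q = ｛ z ｝} x∈)
      f′∈ : ∀ x x∈ → f′ x x∈ ∈ Q ∖ ｛ f z z∈P ｝
      f′∈ x x∈ = ∖-intro {P = Q} {Q = ｛ f z z∈P ｝} (f∈Q x (∖-projₗ {P = P} {Q = ｛ z ｝} x∈))
        (∖｛｝⇒≢ {P = P} x∈ ∘ f-inj x _ z z∈P ∘ ∈｛｝⇒≡)
      f′-inj : ∀ x x∈ y y∈ → f′ x x∈ ≡ f′ y y∈ → x ≡ y
      f′-inj x x∈ y y∈ = f-inj x _ y _

  ⊆-or-witness : (P Q : VSet n) → P ⊆ Q ⊎ ∃[ x ] (x ∈ P × ¬ x ∈ Q)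
  ⊆-or-witness P Q with 1 ≤? count (P ∖ Q)
  ... | yes 1≤ with count-witness (P ∖ Q) 1≤
  ...   | x , x∈P∖Q = inj₂ (x , ∖-projₗ {P = P} {Q = Q} x∈P∖Q , ∖-projᵣ {P = P} {Q = Q} x∈P∖Q)
  ⊆-or-witness P Q | no 1≰ = inj₁ P⊆Q
    where
    P⊆Q : P ⊆ Q
    P⊆Q x x∈P with Q x in Qx
    ... | true = refl
    ... | false = ⊥-elim (1≰ (count-nonempty {P = P ∖ Q} (∖-intro {P = P} {Q = Q} x∈P (not-¬ Qx))))

module Reachability where

  open import Defs using (VSet; Reach; here; step; removeEdge; inducedAdj; count; _⊆_)
  open Counting
  open import Data.Nat using (ℕ; zero; suc; _≤_; _≤?_; s≤s)
  open import Data.Nat.Properties using (<-irrefl; ≤-trans)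
  open import Data.Bool using (Bool; true; false; _∧_; _∨_; not)
  open import Data.Bool.Properties using (∧-conicalˡ; ∧-conicalʳ; ∧-zeroʳ; ∨-zeroʳ; ¬-not)
  open import Data.Fin using (Fin)
  open import Data.Fin.Properties using (_≟_)
  open import Data.Product using (∃-syntax; _×_; _,_; proj₁; proj₂)
  open import Data.Sum using (_⊎_; inj₁; inj₂)
  open import Data.Empty using (⊥-elim)
  open import Function using (_∘_)
  open import Relation.Nullary using (¬_; yes; no; Dec; does)
  open import Relation.Nullary.Decidable using (dec-true)
  open import Relation.Binary.PropositionalEquality

  Adj : ℕ → Set
  Adj n = Fin n → Fin n → Bool

  private variable
    n : ℕ
    A B : Adj n
    u v w x y z : Fin n

  infix 4 _⊆₂_

  _⊆₂_ : Adj n → Adj n → Set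
  A ⊆₂ B = ∀ {x y} → A x y ≡ true → B x y ≡ true

  SymmetricAdj : Adj n → Set
  SymmetricAdj A = ∀ {x y} → A x y ≡ true → A y x ≡ true

  reach-mono : A ⊆₂ B → Reach A u w → Reach B u w
  reach-mono A⊆B here = here
  reach-mono A⊆B (step e r) = step (A⊆B e) (reach-mono A⊆B r)

  reach-trans : Reach A u v → Reach A v w → Reach A u w
  reach-trans here r = r
  reach-trans (step e r₁) r₂ = step e (reach-trans r₁ r₂)

  reach-snoc : Reach A u v → A v w ≡ true → Reach A u w
  reach-snoc r e = reach-trans r (step e here)

  reach-sym : SymmetricAdj A → Reach A u v → Reach A v u
  reach-sym sym-A here = here
  reach-sym sym-A (step e r) = reach-snoc (reach-sym sym-A r) (sym-A e)

  module _ {A : Adj n} {u v : Fin n} where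

    private
      pair-false : ∀ {a b c d : Fin n} → ¬ (a ≡ b × c ≡ d) → (｛ b ｝ a ∧ ｛ d ｝ c) ≡ false
      pair-false {a} {b} {c} {d} ne = ¬-not λ h →
        ne (∈｛｝⇒≡ {x = a} {z = b} (∧-conicalˡ _ _ h) , ∈｛｝⇒≡ {x = c} {z = d} (∧-conicalʳ (｛ b ｝ a) _ h))

    removeEdge-intro : A x y ≡ true → ¬ (x ≡ u × y ≡ v) → ¬ (x ≡ v × y ≡ u) → removeEdge A u v x y ≡ true
    removeEdge-intro e ne₁ ne₂ rewrite e | pair-false ne₁ | pair-false ne₂ = refl

    removeEdge-⊆ : removeEdge A u v ⊆₂ A
    removeEdge-⊆ {x} {y} = ∧-conicalˡ (A x y) _

    removeEdge-¬uv : ¬ removeEdge A u v u v ≡ true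
    removeEdge-¬uv h with ｛ u ｝ u | ∈｛ u ｝ | ｛ v ｝ v | ∈｛ v ｝
    ... | true | refl | true | refl with () ← trans (sym (∧-zeroʳ (A u v))) h

    removeEdge-¬vu : ¬ removeEdge A u v v u ≡ true
    removeEdge-¬vu h with ｛ u ｝ u | ∈｛ u ｝ | ｛ v ｝ v | ∈｛ v ｝
    ... | true | refl | true | refl with () ←
      trans (sym (∧-zeroʳ (A v u))) (subst (λ b → A v u ∧ not b ≡ true) (∨-zeroʳ _) h)

  removeEdge-endpoints : removeEdge A u v x y ≡ true → ¬ (x ≡ u × y ≡ v) × ¬ (x ≡ v × y ≡ u)
  removeEdge-endpoints {A = A} h = (λ { (refl , refl) → removeEdge-¬uv {A = A} h })
                                 , (λ { (refl , refl) → removeEdge-¬vu {A = A} h })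

  removeEdge-swap : removeEdge A u v ⊆₂ removeEdge A v u
  removeEdge-swap {A = A} h with removeEdge-endpoints {A = A} h
  ... | ne₁ , ne₂ = removeEdge-intro {A = A} (removeEdge-⊆ {A = A} h) ne₂ ne₁

  removeEdge-sym : SymmetricAdj A → SymmetricAdj (removeEdge A u v)
  removeEdge-sym {A = A} sym-A h with removeEdge-endpoints {A = A} h
  ... | ne₁ , ne₂ = removeEdge-intro {A = A} (sym-A (removeEdge-⊆ {A = A} h))
    (λ (p , q) → ne₂ (q , p)) (λ (p , q) → ne₁ (q , p))

  removeEdge-mono : A ⊆₂ B → removeEdge A u v ⊆₂ removeEdge B u v
  removeEdge-mono {A = A} {B = B} A⊆B h with removeEdge-endpoints {A = A} h
  ... | ne₁ , ne₂ = removeEdge-intro {A = B} (A⊆B (removeEdge-⊆ {A = A} h)) ne₁ ne₂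

  reach-avoiding : (u v : Fin n) → Reach A x z →
    Reach (removeEdge A u v) x z ⊎ Reach (removeEdge A u v) x u ⊎ Reach (removeEdge A u v) x v
  reach-avoiding u v here = inj₁ here
  reach-avoiding {A = A} {x = x} u v (step e r) with x ≟ u | x ≟ v
  ... | yes refl | _ = inj₂ (inj₁ here)
  ... | no _ | yes refl = inj₂ (inj₂ here)
  ... | no x≢u | no x≢v with removeEdge-intro {A = A} e (x≢u ∘ proj₁) (x≢v ∘ proj₁) | reach-avoiding u v r
  ...   | e′ | inj₁ r′ = inj₁ (step e′ r′)
  ...   | e′ | inj₂ (inj₁ r′) = inj₂ (inj₁ (step e′ r′))
  ...   | e′ | inj₂ (inj₂ r′) = inj₂ (inj₂ (step e′ r′))

  module _ {A : Adj n} {W : VSet n} where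

    inducedAdj-intro : x ∈ W → y ∈ W → A x y ≡ true → inducedAdj A W x y ≡ true
    inducedAdj-intro x∈W y∈W e rewrite x∈W | y∈W = e

    inducedAdj-elim : inducedAdj A W x y ≡ true → x ∈ W × y ∈ W × A x y ≡ true
    inducedAdj-elim {x} {y} h =
      ∧-conicalˡ (W x) _ h , ∧-conicalˡ (W y) _ (∧-conicalʳ (W x) _ h) , ∧-conicalʳ (W y) _ (∧-conicalʳ (W x) _ h)

    inducedAdj-⊆ : inducedAdj A W ⊆₂ A
    inducedAdj-⊆ h = proj₂ (proj₂ (inducedAdj-elim h))

    inducedAdj-sym : SymmetricAdj A → SymmetricAdj (inducedAdj A W)
    inducedAdj-sym sym-A h with inducedAdj-elim h
    ... | x∈W , y∈W , e = inducedAdj-intro y∈W x∈W (sym-A e)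

  private
    ∨-true : ∀ {a b} → a ∨ b ≡ true → a ≡ true ⊎ b ≡ true
    ∨-true {true} _ = inj₁ refl
    ∨-true {false} h = inj₂ h

    does-true : ∀ {P : Set} (P? : Dec P) → does P? ≡ true → P
    does-true (yes p) _ = p

  expand : Adj n → VSet n → VSet n
  expand A X w = X w ∨ does (1 ≤? count (λ v → X v ∧ A v w))

  module _ {A : Adj n} {X : VSet n} where

    expand-old : w ∈ X → w ∈ expand A X
    expand-old w∈X rewrite w∈X = refl

    expand-new : v ∈ X → A v w ≡ true → w ∈ expand A X
    expand-new {v} {w} v∈X e = trans (cong (X w ∨_) (dec-true (1 ≤? count (λ v → X v ∧ A v w))
      (count-nonempty {P = λ v → X v ∧ A v w} (∩-intro {P = X} {Q = λ v → A v w} v∈X e)))) (∨-zeroʳ (X w))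

    expand-elim : w ∈ expand A X → w ∈ X ⊎ ∃[ v ] (v ∈ X × A v w ≡ true)
    expand-elim {w} h with ∨-true {X w} h
    ... | inj₁ w∈X = inj₁ w∈X
    ... | inj₂ 1≤ with count-witness (λ v → X v ∧ A v w) (does-true (1 ≤? _) 1≤)
    ...   | v , v∈ = inj₂ (v , ∩-projₗ {P = X} {Q = λ v → A v w} v∈ , ∩-projᵣ {P = X} {Q = λ v → A v w} v∈)

  expand-mono : {X Y : VSet n} → X ⊆ Y → expand A X ⊆ expand A Y
  expand-mono {A = A} {X} {Y} X⊆Y w w∈ with expand-elim {A = A} {X = X} w∈
  ... | inj₁ w∈X = expand-old {A = A} {X = Y} (X⊆Y w w∈X)
  ... | inj₂ (v , v∈X , e) = expand-new {A = A} {X = Y} (X⊆Y v v∈X) e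

  ball : Adj n → Fin n → ℕ → VSet n
  ball A u zero = ｛ u ｝
  ball A u (suc i) = expand A (ball A u i)

  ball-center : ∀ i → u ∈ ball A u i
  ball-center {u = u} zero = ∈｛ u ｝
  ball-center {A = A} (suc i) = expand-old {A = A} (ball-center i)

  ball-sound : ∀ i → w ∈ ball A u i → Reach A u w
  ball-sound zero w∈ rewrite ∈｛｝⇒≡ w∈ = here
  ball-sound {A = A} (suc i) w∈ with expand-elim {A = A} w∈
  ... | inj₁ w∈ball = ball-sound i w∈ball
  ... | inj₂ (v , v∈ball , e) = reach-snoc (ball-sound i v∈ball) e

  ball-stable-or-grows : ∀ (A : Adj n) u i → ball A u (suc i) ⊆ ball A u i ⊎ suc i ≤ count (ball A u i)
  ball-stable-or-grows A u zero = inj₂ (count-nonempty {P = ball A u zero} (ball-center {u = u} {A = A} zero))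
  ball-stable-or-grows A u (suc i) with ball-stable-or-grows A u i
  ... | inj₁ stable = inj₁ (expand-mono {A = A} stable)
  ... | inj₂ grown with ⊆-or-witness (ball A u (suc i)) (ball A u i)
  ...   | inj₁ stable = inj₁ (expand-mono {A = A} stable)
  ...   | inj₂ (w , w∈new , w∉old) =
          inj₂ (≤-trans (s≤s grown)
            (count-mono-< {P = ball A u i} {Q = ball A u (suc i)} (λ x → expand-old {A = A}) w∈new w∉old))

  ball-stable : ∀ (A : Adj n) u → ball A u (suc n) ⊆ ball A u n
  ball-stable {n} A u with ball-stable-or-grows A u n
  ... | inj₁ stable = stable
  ... | inj₂ too-big = ⊥-elim (<-irrefl refl (≤-trans too-big (count≤n (ball A u n))))

  abstract

    reachable : Adj n → Fin n → VSet n
    reachable {n} A u = ball A u n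

    reachable-sound : w ∈ reachable A u → Reach A u w
    reachable-sound {n} = ball-sound n

    reachable-complete : Reach A u w → w ∈ reachable A u
    reachable-complete {n} {A = A} {u = u} = go (ball-center n)
      where
      go : x ∈ ball A u n → Reach A x w → w ∈ ball A u n
      go x∈ here = x∈
      go x∈ (step e r) = go (ball-stable A u _ (expand-new {A = A} x∈ e)) r


module Tree {n : ℕ} (T : Graph n) (T-tree : IsTree T) where

  open Counting
  open Reachability
  open import Data.Nat using (ℕ; zero; suc; _+_; _≤_; _<_)
  open import Data.Nat.Properties using (≤-refl; ≤-trans; ≤-pred)
  open import Data.Bool using (true; false; _∧_; not)
  open import Data.Fin using (Fin)
  open import Data.Fin.Properties using (_≟_)
  open import Data.Product using (∃-syntax; _×_; _,_; proj₁; proj₂)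
  open import Data.Sum using (_⊎_; inj₁; inj₂)
  open import Data.Empty using (⊥; ⊥-elim)
  open import Function using (_∘_)
  open import Relation.Nullary using (¬_; yes; no)
  open import Relation.Binary.PropositionalEquality

  private
    A = adj T
    connected = proj₁ T-tree
    bridge = proj₂ T-tree
    variable
      u v w x y z : Fin n

  adj-symmetric : SymmetricAdj A
  adj-symmetric {x} {y} e = trans (adj-sym T y x) e

  adj-≢ : A x y ≡ true → ¬ x ≡ y
  adj-≢ {x} e refl with () ← trans (sym e) (irrefl T x)

  Side : Fin n → Fin n → Fin n → Set
  Side u v = Reach (removeEdge A u v) u

  side : Fin n → Fin n → VSet n
  side u v = reachable (removeEdge A u v) u

  side-sound : z ∈ side u v → Side u v z
  side-sound = reachable-sound

  side-complete : Side u v z → z ∈ side u v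
  side-complete = reachable-complete

  side-component : ∀ u v → IsComponentOfRemoval T u v (side u v)
  side-component u v z = side-sound , side-complete

  private
    removeEdge-symmetric : SymmetricAdj (removeEdge A u v)
    removeEdge-symmetric = removeEdge-sym {A = A} adj-symmetric

    reverse : Reach (removeEdge A u v) x y → Reach (removeEdge A u v) y x
    reverse = reach-sym removeEdge-symmetric

  side-cover : ∀ u v z → Side u v z ⊎ Side v u z
  side-cover u v z with reach-avoiding {A = A} u v (connected z u)
  ... | inj₁ r = inj₁ (reverse r)
  ... | inj₂ (inj₁ r) = inj₁ (reverse r)
  ... | inj₂ (inj₂ r) = inj₂ (reach-mono (removeEdge-swap {A = A}) (reverse r))

  far-end-off-side : A u v ≡ true → ¬ Side u v v
  far-end-off-side = bridge _ _

  sides-disjoint : A u v ≡ true → Side u v z → Side v u z → ⊥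
  sides-disjoint e p q = bridge _ _ e (reach-trans p (reverse (reach-mono (removeEdge-swap {A = A}) q)))

  side-complement : A u v ≡ true → ∀ z → side v u z ≡ not (side u v z)
  side-complement {u} {v} e z with side u v z in uv | side v u z in vu
  ... | true | true = ⊥-elim (sides-disjoint e (side-sound uv) (side-sound vu))
  ... | true | false = refl
  ... | false | true = refl
  ... | false | false with side-cover u v z
  ...   | inj₁ s with () ← trans (sym (side-complete s)) uv
  ...   | inj₂ s with () ← trans (sym (side-complete s)) vu

  -- A vertex z in two branches at w would close a cycle w x ⋯ z ⋯ y w.
  branches-disjoint : ¬ x ≡ y → A w x ≡ true → A w y ≡ true → Side x w z → Side y w z → ⊥
  branches-disjoint {x} {y} {w} x≢y wx wy p q with reach-avoiding {A = removeEdge A x w} y w p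
  ... | inj₁ p′ = bridge y w (adj-symmetric wy)
        (reach-snoc
          (reach-trans q (reverse (reach-mono (removeEdge-mono {A = removeEdge A x w} (removeEdge-⊆ {A = A})) p′)))
                    (removeEdge-intro {A = A} (adj-symmetric wx) (x≢y ∘ proj₁) (λ (x≡w , _) → adj-≢ wx (sym x≡w))))
  ... | inj₂ (inj₁ p′) = bridge x w (adj-symmetric wx)
        (reach-snoc (reach-mono (removeEdge-⊆ {A = removeEdge A x w}) p′)
                    (removeEdge-intro {A = A} (adj-symmetric wy) (x≢y ∘ sym ∘ proj₁) (λ (y≡w , _) → adj-≢ wy (sym y≡w))))
  ... | inj₂ (inj₂ p′) = bridge x w (adj-symmetric wx) (reach-mono (removeEdge-⊆ {A = removeEdge A x w}) p′)

  branch-inside : A w y ≡ true → A x w ≡ true → ¬ y ≡ x → Side y w z → Side w x z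
  branch-inside {w} {y} {x} {z} wy xw y≢x s with side-cover x w z
  ... | inj₂ s′ = s′
  ... | inj₁ s′ = ⊥-elim (branches-disjoint y≢x wy (adj-symmetric xw) s s′)

  side-shrinks : A x y ≡ true → A w x ≡ true → ¬ y ≡ w → count (side y x) < count (side x w)
  side-shrinks {x} {y} {w} xy wx y≢w =
    count-mono-< {P = side y x} {Q = side x w} (λ z → side-complete ∘ branch-inside xy wx y≢w ∘ side-sound)
      (side-complete here) (far-end-off-side (adj-symmetric xy) ∘ side-sound)

  -- A tree admits no endless non-backtracking walk: the side ahead strictly shrinks at each step.
  walk-terminates : (R : Fin n → Fin n → Set) →
    (∀ {w x} → A w x ≡ true → R w x → ∃[ y ] (A x y ≡ true × ¬ y ≡ w × R x y)) →
    A w x ≡ true → ¬ R w x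
  walk-terminates R continue = descend _ ≤-refl
    where
    descend : ∀ m {w x} → count (side x w) ≤ m → A w x ≡ true → ¬ R w x
    descend zero {w} {x} ∣side∣≤0 _ _ with () ← ≤-trans (count-nonempty {P = side x w} (side-complete here)) ∣side∣≤0
    descend (suc m) ∣side∣≤ wx r with continue wx r
    ... | y , xy , y≢w , r′ = descend m (≤-pred (≤-trans (side-shrinks xy wx y≢w) ∣side∣≤)) xy r′

  toward : {W : VSet n} → IsSubtreeSet T W → w ∈ W → z ∈ W → ¬ z ≡ w →
    ∃[ x ] (x ∈ W × A w x ≡ true × Side x w z)
  toward {w} {z} {W} W-subtree w∈W z∈W = go (W-subtree z w z∈W w∈W)
    where
    go : ∀ {z} → Reach (inducedAdj A W) z w → ¬ z ≡ w → ∃[ x ] (x ∈ W × A w x ≡ true × Side x w z)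
    go here z≢w = ⊥-elim (z≢w refl)
    go {z} (step {v = z′} e r) z≢w with inducedAdj-elim {A = A} {W = W} e | z′ ≟ w
    ... | z∈W , _ , zz′ | yes refl = z , z∈W , adj-symmetric zz′ , here
    ... | _ , _ , zz′ | no z′≢w with go r z′≢w
    ...   | x , x∈W , wx , s =
            x , x∈W , wx , reach-snoc s (removeEdge-intro {A = A} (adj-symmetric zz′) (z≢w ∘ proj₂) (z′≢w ∘ proj₁))

  -- A vertex of W on v's side reaches v inside W without crossing uv, hence inside W ∩ side v u.
  subtree-∩-side : {W : VSet n} → IsSubtreeSet T W → u ∈ W → v ∈ W → A u v ≡ true → IsSubtreeSet T (W ∩ side v u)
  subtree-∩-side {u} {v} {W} W-subtree u∈W v∈W uv a b a∈ b∈ =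
    reach-trans (to-v a∈) (reach-sym (inducedAdj-sym {A = A} {W = W ∩ side v u} adj-symmetric) (to-v b∈))
    where
    B = inducedAdj A W
    W′ = W ∩ side v u

    B-uv⊆A-vu : removeEdge B u v ⊆₂ removeEdge A v u
    B-uv⊆A-vu = removeEdge-swap {A = A} ∘ removeEdge-mono {A = B} (inducedAdj-⊆ {A = A} {W = W})

    back-on-side : ∀ {x y} → Reach (removeEdge B u v) x y → Side v u y → Side v u x
    back-on-side r s = reach-trans s (reverse (reach-mono B-uv⊆A-vu r))

    lift : ∀ {x y} → Reach (removeEdge B u v) x y → Side v u y → Reach (inducedAdj A W′) x y
    lift here _ = here
    lift (step e r) s with inducedAdj-elim {A = A} {W = W} (removeEdge-⊆ {A = B} e)
    ... | x∈W , x′∈W , xx′ = step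
          (inducedAdj-intro {A = A} {W = W′}
            (∩-intro {P = W} {Q = side v u} x∈W (side-complete (back-on-side (step e r) s)))
            (∩-intro {P = W} {Q = side v u} x′∈W (side-complete (back-on-side r s))) xx′)
          (lift r s)

    to-v : ∀ {x} → x ∈ W′ → Reach (inducedAdj A W′) x v
    to-v {x} x∈ with reach-avoiding {A = B} u v (W-subtree x v (∩-projₗ {P = W} {Q = side v u} x∈) v∈W)
    ... | inj₁ r = lift r here
    ... | inj₂ (inj₂ r) = lift r here
    ... | inj₂ (inj₁ r) = ⊥-elim (far-end-off-side (adj-symmetric uv)
            (reach-trans (side-sound (∩-projᵣ {P = W} {Q = side v u} x∈)) (reach-mono B-uv⊆A-vu r)))

  terminals : VSet n → Fin n → Fin n → ℕ
  terminals S u v = count (S ∩ side u v)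

  terminals-sum : ∀ S → A u v ≡ true → terminals S u v + terminals S v u ≡ count S
  terminals-sum S uv = sym (trans (count-split S (side _ _))
    (cong (terminals S _ _ +_) (count-cong λ z → cong (S z ∧_) (sym (side-complement uv z)))))

module Spider where

  open Counting
  open Reachability using (reach-trans)
  open import Data.Nat using (zero; suc; _+_; _≤_; z≤n; s≤s)
  open import Data.Nat.Properties as ℕ
    using (≤-trans; ≤-pred; ≤-reflexive; ≤-antisym; ≤∧≢⇒<; ≰⇒>; +-cancelʳ-≤; +-comm; n≤1+n)
  open import Data.Bool using (true; false; not)
  import Data.Bool.Properties as Bool
  open import Data.Fin using (Fin)
  open import Data.Fin.Properties using (_≟_; any?)
  open import Data.Product using (∃-syntax; _×_; _,_; proj₁; proj₂)
  open import Data.Sum using (_⊎_; inj₁; inj₂)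
  open import Data.Empty using (⊥; ⊥-elim)
  open import Function using (_∘_)
  open import Relation.Nullary using (¬_; yes; no; Dec; contradiction)
  open import Relation.Nullary.Decidable using (_×-dec_; ¬?; decidable-stable)
  open import Relation.Binary.PropositionalEquality

  module _ {n : ℕ} (T : Graph n) (T-tree : IsTree T) (S W : VSet n)
    (minimal : IsMinimalSubtreeContaining T S W) (four≤∣S∣ : 4 ≤ count S)
    (unbalanced : ∀ {u v} → adj T u v ≡ true →
                  2 ≤ Tree.terminals T T-tree S u v → 2 ≤ Tree.terminals T T-tree S v u → ⊥)
    where

    open Tree T T-tree

    private
      A = adj T
      S⊆W = proj₁ minimal
      W-subtree = proj₁ (proj₂ minimal)
      W-minimal = proj₂ (proj₂ minimal)
      τ = terminals S
      variable
        u v w x y z : Fin n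

    -- By minimality: otherwise W ∩ side v u would be a smaller subtree containing S.
    terminals-positive : u ∈ W → v ∈ W → A u v ≡ true → 1 ≤ τ u v
    terminals-positive {u} {v} u∈W v∈W uv with τ u v in τ≡
    ... | suc _ = s≤s z≤n
    ... | zero = ⊥-elim (far-end-off-side (adj-symmetric uv)
                  (side-sound (∩-projᵣ {P = W} {Q = side v u} (W-minimal W′ W′⊆W S⊆W′ W′-subtree u u∈W))))
      where
      W′ = W ∩ side v u
      W′⊆W : W′ ⊆ W
      W′⊆W z = ∩-projₗ {P = W} {Q = side v u}
      W′-subtree = subtree-∩-side W-subtree u∈W v∈W uv
      S⊆W′ : S ⊆ W′
      S⊆W′ z z∈S = ∩-intro {P = W} {Q = side v u} (S⊆W z z∈S)
        (trans (side-complement uv z) (cong not (∉⇒≡false {P = side u v} λ z∈side →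
          contradiction (subst (1 ≤_) τ≡
            (count-nonempty {P = S ∩ side u v} (∩-intro {P = S} {Q = side u v} z∈S z∈side))) λ ())))

    terminals-one : u ∈ W → v ∈ W → A u v ≡ true → ¬ τ v u ≡ 1 → τ u v ≡ 1
    terminals-one u∈W v∈W uv τvu≢1 = ≤-antisym (≤-pred (≰⇒> (λ 2≤τuv → unbalanced uv 2≤τuv 2≤τvu)))
      (terminals-positive u∈W v∈W uv)
      where
      2≤τvu = ≤∧≢⇒< (terminals-positive v∈W u∈W (adj-symmetric uv)) (τvu≢1 ∘ sym)

    unique-terminal : τ u v ≡ 1 → z ∈ S → Side u v z → y ∈ S → Side u v y → z ≡ y
    unique-terminal {u} {v} {z} {y} τ≡1 z∈S z-side y∈S y-side with z ≟ y
    ... | yes z≡y = z≡y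
    ... | no z≢y = contradiction (subst (2 ≤_) τ≡1 (count-pair {P = S ∩ side u v}
            (∩-intro {P = S} {Q = side u v} z∈S (side-complete z-side))
            (∩-intro {P = S} {Q = side u v} y∈S (side-complete y-side)) z≢y)) λ { (s≤s ()) }

    -- The hubs will be the branching vertex of the spider.
    Hub : Fin n → Set
    Hub w = ∀ x → x ∈ W → A w x ≡ true → τ x w ≡ 1

    hub-or-witness : ∀ w → Hub w ⊎ ∃[ x ] (x ∈ W × A w x ≡ true × ¬ τ x w ≡ 1)
    hub-or-witness w with any? (λ x → (W x Bool.≟ true) ×-dec (A w x Bool.≟ true) ×-dec ¬? (τ x w ℕ.≟ 1))
    ... | yes witness = inj₂ witness
    ... | no none = inj₁ λ x x∈W wx → decidable-stable (τ x w ℕ.≟ 1) λ τ≢1 → none (x , x∈W , wx , τ≢1)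

    hub? : ∀ w → Dec (Hub w)
    hub? w with hub-or-witness w
    ... | inj₁ hub = yes hub
    ... | inj₂ (x , x∈W , wx , τ≢1) = no λ hub → τ≢1 (hub x x∈W wx)

    private
      neighbours : Fin n → VSet n
      neighbours w = W ∩ A w

    -- Away from a hub, w has a branch x beyond which lies more than one terminal, so the
    -- single terminal on w's side of wx must sit in every other branch at w.
    module _ {w x} (w∈W : w ∈ W) (x∈W : x ∈ W) (wx : A w x ≡ true) (τxw≢1 : ¬ τ x w ≡ 1) where

      private
        N∖x = neighbours w ∖ ｛ x ｝

        other-neighbour : y ∈ N∖x → y ∈ W × A w y ≡ true × ¬ y ≡ x
        other-neighbour y∈ = ∩-projₗ {P = W} {Q = A w} y∈N , ∩-projᵣ {P = W} {Q = A w} y∈N , ∖｛｝⇒≢ {P = neighbours w} y∈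
          where y∈N = ∖-projₗ {P = neighbours w} {Q = ｛ x ｝} y∈

        branch-terminal : y ∈ N∖x → ∃[ z ] (z ∈ S × Side y w z × Side w x z)
        branch-terminal {y} y∈ with other-neighbour y∈
        ... | y∈W , wy , y≢x with count-witness (S ∩ side y w) (terminals-positive y∈W w∈W (adj-symmetric wy))
        ...   | z , z∈ = z , z∈S , z-side , branch-inside wy (adj-symmetric wx) y≢x z-side
          where
          z∈S = ∩-projₗ {P = S} {Q = side y w} z∈
          z-side = side-sound (∩-projᵣ {P = S} {Q = side y w} z∈)

        τwx≡1 = terminals-one w∈W x∈W wx τxw≢1

        one-other-branch : y ∈ N∖x → z ∈ N∖x → y ≡ z
        one-other-branch {y} {z} y∈ z∈ with y ≟ z | branch-terminal y∈ | branch-terminal z∈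
        ... | yes y≡z | _ | _ = y≡z
        ... | no y≢z | t , t∈S , t-y , t-x | t′ , t′∈S , t′-z , t′-x
          rewrite unique-terminal τwx≡1 t∈S t-x t′∈S t′-x =
            ⊥-elim (branches-disjoint y≢z (proj₁ (proj₂ (other-neighbour y∈))) (proj₁ (proj₂ (other-neighbour z∈)))
                      t-y t′-z)

        no-other-branch-at-terminal : y ∈ N∖x → ¬ w ∈ S
        no-other-branch-at-terminal y∈ w∈S with branch-terminal y∈
        ... | t , t∈S , t-y , t-x rewrite unique-terminal τwx≡1 t∈S t-x w∈S here =
          far-end-off-side (adj-symmetric (proj₁ (proj₂ (other-neighbour y∈)))) t-y

      private
        others-≥ : ∀ {d} → suc d ≤ count (neighbours w) → d ≤ count N∖x
        others-≥ d<deg = ≤-pred (≤-trans d<deg (count-≤-remove (neighbours w) x))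

      non-hub-degree : ¬ 3 ≤ degIn T W w
      non-hub-degree 3≤deg =
        let y , z , y∈ , z∈ , y≢z = count-pair-witness N∖x (others-≥ 3≤deg) in y≢z (one-other-branch y∈ z∈)

      non-hub-degree-two : degIn T W w ≡ 2 → ¬ w ∈ S
      non-hub-degree-two deg≡2 =
        let y , y∈ = count-witness N∖x (others-≥ (≤-reflexive (sym deg≡2))) in no-other-branch-at-terminal y∈

    hub-degree : w ∈ W → Hub w → count S ≤ suc (degIn T W w)
    hub-degree {w} w∈W hub =
      ≤-trans (count-≤-remove S w)
        (s≤s (count-injection {P = S ∖ ｛ w ｝} {Q = neighbours w} branch branch∈N branch-injective))
      where
      branch-of : ∀ z → z ∈ S ∖ ｛ w ｝ → ∃[ x ] (x ∈ W × A w x ≡ true × Side x w z)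
      branch-of z z∈ = toward W-subtree w∈W (S⊆W z (∖-projₗ {P = S} {Q = ｛ w ｝} z∈)) (∖｛｝⇒≢ {P = S} z∈)

      branch : ∀ z → z ∈ S ∖ ｛ w ｝ → Fin n
      branch z z∈ = proj₁ (branch-of z z∈)

      branch∈N : ∀ z z∈ → branch z z∈ ∈ neighbours w
      branch∈N z z∈ = let _ , x∈W , wx , _ = branch-of z z∈ in ∩-intro {P = W} {Q = A w} x∈W wx

      branch-injective : ∀ z z∈ y y∈ → branch z z∈ ≡ branch y y∈ → z ≡ y
      branch-injective z z∈ y y∈ same-branch =
        let x , x∈W , wx , z-side = branch-of z z∈
            _ , _ , _ , y-side = branch-of y y∈
        in unique-terminal (hub x x∈W wx) (∖-projₗ {P = S} {Q = ｛ w ｝} z∈) z-side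
             (∖-projₗ {P = S} {Q = ｛ w ｝} y∈) (subst (λ x → Side x w y) (sym same-branch) y-side)

    -- Without hubs, one could walk forever, always into a branch holding ≠ 1 terminals.
    hub-exists : ∃[ b ] (b ∈ W × Hub b)
    hub-exists with any? (λ w → (W w Bool.≟ true) ×-dec hub? w)
    ... | yes found = found
    ... | no none =
      let s₀ , s₀∈S = count-witness S (≤-trans (s≤s z≤n) four≤∣S∣)
          s₀∈W = S⊆W s₀ s₀∈S
          x , x∈W , s₀x , τ≢1 = non-hub s₀∈W
      in ⊥-elim (walk-terminates R continue s₀x (s₀∈W , x∈W , τ≢1))
      where
      non-hub : w ∈ W → ∃[ x ] (x ∈ W × A w x ≡ true × ¬ τ x w ≡ 1)
      non-hub {w} w∈W with hub-or-witness w
      ... | inj₁ hub = ⊥-elim (none (w , w∈W , hub))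
      ... | inj₂ witness = witness

      R : Fin n → Fin n → Set
      R w x = w ∈ W × x ∈ W × ¬ τ x w ≡ 1

      continue : A w x ≡ true → R w x → ∃[ y ] (A x y ≡ true × ¬ y ≡ w × R x y)
      continue {w} {x} wx (w∈W , x∈W , τxw≢1) =
        let y , y∈W , xy , τyx≢1 = non-hub x∈W
        in y , xy , (λ y≡w → τyx≢1 (subst (λ y → τ y x ≡ 1) (sym y≡w) (terminals-one w∈W x∈W wx τxw≢1)))
             , x∈W , y∈W , τyx≢1

    -- Walking from one hub toward another, the side left behind keeps ≥ 2 terminals, so the walk
    -- could never stop: not even at the second hub, whose branches carry one terminal each.
    hub-unique : u ∈ W → Hub u → v ∈ W → Hub v → u ≡ v
    hub-unique {b₁} {b₂} b₁∈W hub₁ b₂∈W hub₂ with b₁ ≟ b₂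
    ... | yes b₁≡b₂ = b₁≡b₂
    ... | no b₁≢b₂ = ⊥-elim (start (toward W-subtree b₁∈W b₂∈W (b₁≢b₂ ∘ sym)))
      where
      R : Fin n → Fin n → Set
      R w x = w ∈ W × x ∈ W × 2 ≤ τ w x × Side x w b₂

      continue : A w x ≡ true → R w x → ∃[ y ] (A x y ≡ true × ¬ y ≡ w × R x y)
      continue {w} {x} wx (w∈W , x∈W , two≤τwx , b₂-side) with x ≟ b₂
      ... | yes refl = contradiction (subst (2 ≤_) (hub₂ w w∈W (adj-symmetric wx)) two≤τwx) λ { (s≤s ()) }
      ... | no x≢b₂ = advance (toward W-subtree x∈W b₂∈W (x≢b₂ ∘ sym))
        where
        advance : ∃[ y ] (y ∈ W × A x y ≡ true × Side y x b₂) → ∃[ y ] (A x y ≡ true × ¬ y ≡ w × R x y)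
        advance (y , y∈W , xy , b₂-side′) = y , xy , y≢w , x∈W , y∈W , ≤-trans two≤τwx τwx≤τxy , b₂-side′
          where
          y≢w : ¬ y ≡ w
          y≢w refl = sides-disjoint (adj-symmetric wx) b₂-side b₂-side′
          τwx≤τxy : τ w x ≤ τ x y
          τwx≤τxy = count-mono {P = S ∩ side w x} {Q = S ∩ side x y} λ z z∈ →
            ∩-intro {P = S} {Q = side x y} (∩-projₗ {P = S} {Q = side w x} z∈)
              (side-complete (branch-inside (adj-symmetric wx) (adj-symmetric xy) (y≢w ∘ sym)
                (side-sound (∩-projᵣ {P = S} {Q = side w x} z∈))))

      start : ∃[ x ] (x ∈ W × A b₁ x ≡ true × Side x b₁ b₂) → ⊥
      start (x , x∈W , b₁x , b₂-side) = walk-terminates R continue b₁x (b₁∈W , x∈W , two≤τb₁x , b₂-side)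
        where
        two≤τb₁x : 2 ≤ τ b₁ x
        two≤τb₁x = ≤-trans (n≤1+n 2) (+-cancelʳ-≤ 1 3 (τ b₁ x) (subst (4 ≤_)
          (sym (trans (cong (τ b₁ x +_) (sym (hub₁ x x∈W b₁x))) (terminals-sum S b₁x))) four≤∣S∣))

    spider : ∃[ b ] (b ∈ W × 3 ≤ degIn T W b
               × (∀ w → w ∈ W → 3 ≤ degIn T W w → w ≡ b)
               × (∀ w → w ∈ W → degIn T W w ≡ 2 → S w ≡ false)
               × count S ≤ degIn T W b + 1)
    spider = let b , b∈W , hub = hub-exists in b , b∈W , spider-at b∈W hub
      where
      spider-at : ∀ {b} → b ∈ W → Hub b → 3 ≤ degIn T W b
               × (∀ w → w ∈ W → 3 ≤ degIn T W w → w ≡ b)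
               × (∀ w → w ∈ W → degIn T W w ≡ 2 → S w ≡ false)
               × count S ≤ degIn T W b + 1
      spider-at {b} b∈W hub = ≤-pred (≤-trans four≤∣S∣ (hub-degree b∈W hub)) , only-branching , degree-two
                            , subst (count S ≤_) (+-comm 1 (degIn T W b)) (hub-degree b∈W hub)
        where
        only-branching : ∀ w → w ∈ W → 3 ≤ degIn T W w → w ≡ b
        only-branching w w∈W 3≤deg with hub-or-witness w
        ... | inj₁ hub′ = hub-unique w∈W hub′ b∈W hub
        ... | inj₂ (x , x∈W , wx , τ≢1) = ⊥-elim (non-hub-degree w∈W x∈W wx τ≢1 3≤deg)

        degree-two : ∀ w → w ∈ W → degIn T W w ≡ 2 → S w ≡ false
        degree-two w w∈W deg≡2 with hub-or-witness w
        ... | inj₁ hub′ = contradiction (≤-trans four≤∣S∣ (subst (λ d → count S ≤ suc d) deg≡2 (hub-degree w∈W hub′)))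
                            λ { (s≤s (s≤s (s≤s ()))) }
        ... | inj₂ (x , x∈W , wx , τ≢1) = ∉⇒≡false {P = S} (non-hub-degree-two w∈W x∈W wx τ≢1 deg≡2)

module CutDegrees where

  open Counting
  open import Data.Nat using (_+_; _*_; _∸_; _≤_; z≤n)
  open import Data.Nat.Properties
    using (+-*-semiring; ≤-trans; +-mono-≤; *-monoʳ-≤; *-identityˡ; +-comm; module ≤-Reasoning)
  open import Algebra.Properties.Semiring.Sum +-*-semiring using (sum; ∑-distrib-+; *-distribʳ-sum; *-distribˡ-sum)
  open import Data.Bool using (true; false; _∧_; not)
  open import Data.Fin using (Fin)
  open import Data.Bool.Properties using (not-¬)
  open import Function using (_∘_)
  open import Relation.Nullary using (¬_)
  open import Relation.Binary.PropositionalEquality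

  private variable
    n : ℕ

  cut-degree : Graph n → VSet n → Fin n → ℕ
  cut-degree G X x = count (λ y → X x ∧ not (X y) ∧ adj G x y)

  crossing≡sum : (G : Graph n) (X : VSet n) → crossing G X ≡ sum (cut-degree G X)
  crossing≡sum G X = listSum-allFin (cut-degree G X)

  module _ (G : Graph n) (S X : VSet n) where

    private
      a = count (S ∩ X)

    -- Of the S-neighbours of x, those in X are among the other a − 1 vertices of S ∩ X.
    degree-bound : ∀ {x} → x ∈ S ∩ X → degIn G S x ≤ (a ∸ 1) + cut-degree G X x
    degree-bound {x} x∈ = begin
      degIn G S x                                              ≡⟨ count-split (S ∩ adj G x) X ⟩
      count ((S ∩ adj G x) ∩ X) + count ((S ∩ adj G x) ∖ X)    ≤⟨ +-mono-≤ inside across ⟩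
      (a ∸ 1) + cut-degree G X x                               ∎
      where
      open ≤-Reasoning
      inside : count ((S ∩ adj G x) ∩ X) ≤ a ∸ 1
      inside = subst (count ((S ∩ adj G x) ∩ X) ≤_) (cong (_∸ 1) (sym (count-remove {P = S ∩ X} x∈)))
        (count-mono {P = (S ∩ adj G x) ∩ X} {Q = (S ∩ X) ∖ ｛ x ｝} λ y y∈ →
          let y∈S∩adj = ∩-projₗ {P = S ∩ adj G x} {Q = X} y∈
              xy = ∩-projᵣ {P = S} {Q = adj G x} y∈S∩adj
          in ∖-intro {P = S ∩ X} {Q = ｛ x ｝}
               (∩-intro {P = S} {Q = X} (∩-projₗ {P = S} {Q = adj G x} y∈S∩adj) (∩-projᵣ {P = S ∩ adj G x} {Q = X} y∈))
               λ y∈｛x｝ → not-¬ (irrefl G x) (subst (λ z → adj G x z ≡ true) (∈｛｝⇒≡ y∈｛x｝) xy))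

      crosses : ∀ {y} → y ∈ S ∩ adj G x → ¬ y ∈ X → X x ∧ not (X y) ∧ adj G x y ≡ true
      crosses y∈ y∉X rewrite ∩-projᵣ {P = S} {Q = X} x∈ | ∉⇒≡false {P = X} y∉X = ∩-projᵣ {P = S} {Q = adj G x} y∈

      across : count ((S ∩ adj G x) ∖ X) ≤ cut-degree G X x
      across = count-mono {P = (S ∩ adj G x) ∖ X} {Q = λ y → X x ∧ not (X y) ∧ adj G x y} λ y y∈ →
        crosses (∖-projₗ {P = S ∩ adj G x} {Q = X} y∈) (∖-projᵣ {P = S ∩ adj G x} {Q = X} y∈)

    degree-sum-bound : ∀ c q → (∀ x → x ∈ S → c ≤ q * degIn G S x) → a * c ≤ q * (crossing G X + a * (a ∸ 1))
    degree-sum-bound c q c≤deg = begin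
      a * c                                                ≡⟨ cong (_* c) (count≡sum (S ∩ X)) ⟩
      sum (b2n ∘ (S ∩ X)) * c                              ≡⟨ *-distribʳ-sum c (b2n ∘ (S ∩ X)) ⟩
      sum (λ x → b2n ((S ∩ X) x) * c)                      ≤⟨ sum-mono pointwise ⟩
      sum (λ x → q * (b2n ((S ∩ X) x) * (a ∸ 1) + cut-degree G X x))
        ≡⟨ sym (*-distribˡ-sum q (λ x → b2n ((S ∩ X) x) * (a ∸ 1) + cut-degree G X x)) ⟩
      q * sum (λ x → b2n ((S ∩ X) x) * (a ∸ 1) + cut-degree G X x)
        ≡⟨ cong (q *_) (∑-distrib-+ (λ x → b2n ((S ∩ X) x) * (a ∸ 1)) (cut-degree G X)) ⟩
      q * (sum (λ x → b2n ((S ∩ X) x) * (a ∸ 1)) + sum (cut-degree G X))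
        ≡⟨ cong (q *_) (cong₂ _+_ inside-pairs (sym (crossing≡sum G X))) ⟩
      q * (a * (a ∸ 1) + crossing G X)                     ≡⟨ cong (q *_) (+-comm (a * (a ∸ 1)) (crossing G X)) ⟩
      q * (crossing G X + a * (a ∸ 1))                     ∎
      where
      open ≤-Reasoning
      inside-pairs : sum (λ x → b2n ((S ∩ X) x) * (a ∸ 1)) ≡ a * (a ∸ 1)
      inside-pairs = sym (trans (cong (_* (a ∸ 1)) (count≡sum (S ∩ X))) (*-distribʳ-sum (a ∸ 1) (b2n ∘ (S ∩ X))))
      pointwise : ∀ x → b2n ((S ∩ X) x) * c ≤ q * (b2n ((S ∩ X) x) * (a ∸ 1) + cut-degree G X x)
      pointwise x with (S ∩ X) x in x∈
      ... | false = z≤n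
      ... | true rewrite *-identityˡ c | *-identityˡ (a ∸ 1) =
        ≤-trans (c≤deg x (∩-projₗ {P = S} {Q = X} x∈)) (*-monoʳ-≤ q (degree-bound x∈))


module CutBalance where

  open Counting
  open Arithmetic using (balanced-cut-absurd)
  open CutDegrees using (degree-sum-bound)
  open import Data.Nat using (_+_; _*_; _≤_; NonZero)
  open import Data.Nat.Properties using (≤-total; ≤-trans; ≤-reflexive; +-monoʳ-≤; +-identityʳ)
  open import Data.Bool using (true)
  open import Data.Sum using (inj₁; inj₂)
  open import Data.Empty using (⊥)
  open import Relation.Binary.PropositionalEquality

  module _ {n : ℕ} (G T : Graph n) (T-tree : IsTree T) (S : VSet n) (p₁ q₁ p₂ q₂ : ℕ)
    .{{_ : NonZero p₁}} .{{_ : NonZero q₁}} .{{_ : NonZero p₂}}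
    (ρ₁ρ₂≥½ : q₁ * q₂ ≤ 2 * (p₁ * p₂)) (ρ₂≥½ : q₂ ≤ 2 * p₂)
    (min-degree : ∀ x → x ∈ S → p₂ * count S + q₂ ≤ q₂ * degIn G S x)
    (congestion : ∀ {u v} → adj T u v ≡ true → p₁ * crossing G (Tree.side T T-tree u v) + q₁ ≤ q₁ * count S)
    where

    open Tree T T-tree

    private
      smaller-side-absurd : ∀ {u v} → adj T u v ≡ true → 2 ≤ terminals S u v → terminals S u v ≤ terminals S v u → ⊥
      smaller-side-absurd {u} {v} uv 2≤a a≤b =
        balanced-cut-absurd p₁ q₁ p₂ q₂ (crossing G (side u v)) (count S) a ρ₁ρ₂≥½ ρ₂≥½ (congestion uv) 2≤a 2a≤s
          (degree-sum-bound G S (side u v) (p₂ * count S + q₂) q₂ min-degree)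
        where
        a = terminals S u v
        2a≤s : 2 * a ≤ count S
        2a≤s = ≤-trans (+-monoʳ-≤ a (≤-trans (≤-reflexive (+-identityʳ a)) a≤b)) (≤-reflexive (terminals-sum S uv))

    no-balanced-edge : ∀ {u v} → adj T u v ≡ true → 2 ≤ terminals S u v → 2 ≤ terminals S v u → ⊥
    no-balanced-edge {u} {v} uv 2≤a 2≤b with ≤-total (terminals S u v) (terminals S v u)
    ... | inj₁ a≤b = smaller-side-absurd uv 2≤a a≤b
    ... | inj₂ b≤a = smaller-side-absurd (adj-symmetric uv) 2≤b b≤a


module RationalBounds where

  open import Data.Nat as ℕ using (suc; NonZero)
  import Data.Nat.Properties as ℕ
  open import Data.Nat.Coprimality using (Coprime; 1-coprimeTo)
  import Data.Nat.Coprimality as Coprime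
  open import Data.Integer as ℤ using (ℤ; +_)
  import Data.Integer.Properties as ℤ
  open import Data.Rational using (ℚ; mkℚ; Positive; ½; 1ℚ; _*_; _+_; _≤_; *≤*; toℚᵘ; ↥_; ↧ₙ_)
  import Data.Rational.Properties as ℚ
  import Data.Rational.Unnormalised as ℚᵘ
  import Data.Rational.Unnormalised.Properties as ℚᵘ
  open import Relation.Binary.PropositionalEquality

  numerator : ℚ → ℕ
  numerator ρ = ℤ.∣ ↥ ρ ∣

  numerator-nonZero : ∀ ρ → Positive ρ → NonZero (numerator ρ)
  numerator-nonZero (mkℚ (+ suc _) _ _) _ = _

  private
    ℤ→ℚ≡mkℚ : ∀ i → ℤ→ℚ i ≡ mkℚ i 0 (Coprime.sym (1-coprimeTo ℤ.∣ i ∣))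
    ℤ→ℚ≡mkℚ i = ℚ.↥p/↧p≡p (mkℚ i 0 (Coprime.sym (1-coprimeTo ℤ.∣ i ∣)))

  ℤ→ℚ-mono-≤ : ∀ {i j} → i ℤ.≤ j → ℤ→ℚ i ≤ ℤ→ℚ j
  ℤ→ℚ-mono-≤ {i} {j} i≤j = subst₂ _≤_ (sym (ℤ→ℚ≡mkℚ i)) (sym (ℤ→ℚ≡mkℚ j))
    (*≤* (subst₂ ℤ._≤_ (sym (ℤ.*-identityʳ i)) (sym (ℤ.*-identityʳ j)) i≤j))

  affine-bound : ∀ ρ m d → Positive ρ → ρ * ℕ→ℚ m + 1ℚ ≤ ℕ→ℚ d → numerator ρ ℕ.* m ℕ.+ ↧ₙ ρ ℕ.≤ ↧ₙ ρ ℕ.* d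
  affine-bound ρ@(mkℚ (+ p) q _) m d _ ρm+1≤d = extract (ℚᵘ.≤-respˡ-≃ homomorphic (ℚ.toℚᵘ-mono-≤ ρx+1≤y))
    where
    x = mkℚ (+ m) 0 (Coprime.sym (1-coprimeTo m))
    y = mkℚ (+ d) 0 (Coprime.sym (1-coprimeTo d))
    ρx+1≤y : ρ * x + 1ℚ ≤ y
    ρx+1≤y = subst₂ (λ x y → ρ * x + 1ℚ ≤ y) (ℤ→ℚ≡mkℚ (+ m)) (ℤ→ℚ≡mkℚ (+ d)) ρm+1≤d
    homomorphic : toℚᵘ (ρ * x + 1ℚ) ℚᵘ.≃ toℚᵘ ρ ℚᵘ.* toℚᵘ x ℚᵘ.+ toℚᵘ 1ℚ
    homomorphic = ℚᵘ.≃-trans (ℚ.toℚᵘ-homo-+ (ρ * x) 1ℚ) (ℚᵘ.+-congˡ (toℚᵘ 1ℚ) (ℚ.toℚᵘ-homo-* ρ x))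
    extract : toℚᵘ ρ ℚᵘ.* toℚᵘ x ℚᵘ.+ toℚᵘ 1ℚ ℚᵘ.≤ toℚᵘ y → p ℕ.* m ℕ.+ suc q ℕ.≤ suc q ℕ.* d
    extract (ℚᵘ.*≤* ≤ℤ) = ℤ.drop‿+≤+ (subst₂ ℤ._≤_ lhs rhs ≤ℤ)
      where
      lhs : (+ p ℤ.* + m ℤ.* + 1 ℤ.+ + 1 ℤ.* + suc (q ℕ.* 1)) ℤ.* + 1 ≡ + (p ℕ.* m ℕ.+ suc q)
      lhs rewrite ℤ.*-identityʳ (+ p ℤ.* + m ℤ.* + 1 ℤ.+ + 1 ℤ.* + suc (q ℕ.* 1))
                | ℤ.*-identityʳ (+ p ℤ.* + m) | ℤ.*-identityˡ (+ suc (q ℕ.* 1))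
                | ℕ.*-identityʳ q | sym (ℤ.pos-* p m) = refl
      rhs : + d ℤ.* + suc (q ℕ.* 1 ℕ.* 1) ≡ + (suc q ℕ.* d)
      rhs rewrite ℕ.*-identityʳ (q ℕ.* 1) | ℕ.*-identityʳ q | sym (ℤ.pos-* d (suc q)) = cong +_ (ℕ.*-comm d (suc q))

  half-bound : ∀ ρ → Positive ρ → ½ ≤ ρ → ↧ₙ ρ ℕ.≤ 2 ℕ.* numerator ρ
  half-bound (mkℚ (+ p) q _) _ ½≤ρ with ℚ.toℚᵘ-mono-≤ ½≤ρ
  ... | ℚᵘ.*≤* ≤ℤ =
    ℤ.drop‿+≤+ (subst₂ ℤ._≤_ (ℤ.*-identityˡ (+ suc q)) (trans (sym (ℤ.pos-* p 2)) (cong +_ (ℕ.*-comm p 2))) ≤ℤ)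

  half-product-bound : ∀ ρ σ → Positive ρ → Positive σ → ½ ≤ ρ * σ →
    ↧ₙ ρ ℕ.* ↧ₙ σ ℕ.≤ 2 ℕ.* (numerator ρ ℕ.* numerator σ)
  half-product-bound ρ@(mkℚ (+ p) q _) σ@(mkℚ (+ p′) q′ _) _ _ ½≤ρσ
    with ℚᵘ.≤-respʳ-≃ (ℚ.toℚᵘ-homo-* ρ σ) (ℚ.toℚᵘ-mono-≤ ½≤ρσ)
  ... | ℚᵘ.*≤* ≤ℤ = ℤ.drop‿+≤+ (subst₂ ℤ._≤_ (ℤ.*-identityˡ _) pp′2 ≤ℤ)
    where
    pp′2 : (+ p ℤ.* + p′) ℤ.* + 2 ≡ + (2 ℕ.* (p ℕ.* p′))
    pp′2 rewrite sym (ℤ.pos-* p p′) | sym (ℤ.pos-* (p ℕ.* p′) 2) = cong +_ (ℕ.*-comm (p ℕ.* p′) 2)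

  affine-bound-mono : ∀ ρ {c k s} → Positive ρ → + c ℤ.≤ k → ρ * ℤ→ℚ k + 1ℚ ≤ ℕ→ℚ s →
    numerator ρ ℕ.* c ℕ.+ ↧ₙ ρ ℕ.≤ ↧ₙ ρ ℕ.* s
  affine-bound-mono ρ@(mkℚ (+ _) _ _) {c} {s = s} ρ>0 c≤k ρk+1≤s = affine-bound ρ c s ρ>0
    (ℚ.≤-trans (ℚ.+-monoˡ-≤ 1ℚ (ℚ.*-monoˡ-≤-nonNeg ρ (ℤ→ℚ-mono-≤ c≤k))) ρk+1≤s)

open import Data.Nat using (ℕ) renaming (_≤_ to _≤ℕ_; _+_ to _+ℕ_)
open import Data.Integer using (ℤ)
open import Data.Rational using (ℚ; Positive; ½; 1ℚ; _*_; _+_; _≤_; ↧ₙ_)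
open import Data.Bool using (true; false)
open import Data.Product using (_×_; ∃-syntax; _,_)
open import Relation.Binary.PropositionalEquality using (_≡_)
open RationalBounds

lemma2 : ∀ {n : ℕ} (G T : Graph n) (k : ℤ) (ρ₁ ρ₂ : ℚ) (S W : VSet n) →
    Connected G →
    IsSpanningTree G T →
    CongestionAtMost G T k →
    Positive ρ₁ → Positive ρ₂ → ½ ≤ ρ₁ * ρ₂ → ½ ≤ ρ₂ →
    4 ≤ℕ card S →
    ρ₁ * ℤ→ℚ k + 1ℚ ≤ ℕ→ℚ (card S) →
    (∀ s → S s ≡ true → ρ₂ * ℕ→ℚ (card S) + 1ℚ ≤ ℕ→ℚ (degIn G S s)) →
    IsMinimalSubtreeContaining T S W →
    ∃[ b ] (W b ≡ true × 3 ≤ℕ degIn T W b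
           × (∀ w → W w ≡ true → 3 ≤ℕ degIn T W w → w ≡ b)
           × (∀ w → W w ≡ true → degIn T W w ≡ 2 → S w ≡ false)
           × card S ≤ℕ degIn T W b +ℕ 1)
lemma2 G T k ρ₁ ρ₂ S W _ (_ , T-tree) congestion ρ₁>0 ρ₂>0 ½≤ρ₁ρ₂ ½≤ρ₂ 4≤∣S∣ ρ₁k+1≤∣S∣ min-degree minimal =
  Spider.spider T T-tree S W minimal 4≤∣S∣
    (CutBalance.no-balanced-edge G T T-tree S (numerator ρ₁) (↧ₙ ρ₁) (numerator ρ₂) (↧ₙ ρ₂)
      {{numerator-nonZero ρ₁ ρ₁>0}} {{_}} {{numerator-nonZero ρ₂ ρ₂>0}}
      (half-product-bound ρ₁ ρ₂ ρ₁>0 ρ₂>0 ½≤ρ₁ρ₂)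
      (half-bound ρ₂ ρ₂>0 ½≤ρ₂)
      (λ x x∈S → affine-bound ρ₂ (card S) (degIn G S x) ρ₂>0 (min-degree x x∈S))
      (λ uv → affine-bound-mono ρ₁ ρ₁>0 (congestion _ _ uv _ (Tree.side-component T T-tree _ _)) ρ₁k+1≤∣S∣))
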